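{- Let $G=(V,E)$ be a connected finite simple graph with $n=|V|$, let $k$ be the largest cardinality of an independent set of $G$, and let $\mathcal G$ be the graph constructed from $G$ as described in the context. Then every proper stalled subset $\mathcal S$ of the vertex set of $\mathcal G$ has cardinality at most $(2n+1)|E|+k$.
   Context: For a finite simple graph $H$ with vertex set $W$ and a set $F\subseteq W$: a vertex $v\in W\setminus F$ is forced by $F$ if there is $u\in F$ such that $v$ is the unique neighbor of $u$ outside $F$. $F$ is stalled if no vertex of $W\setminus F$ is forced by $F$; $F$ is proper if $F\neq W$. Construction of $\mathcal G$: given $G=(V,E)$ with $n=|V|$, let $E^i=\{e^i : e\in E\}$ for $i=0,1,\dots,2n$ be $2n+1$ pairwise disjoint copies of $E$ (disjoint from $V$), and let $\varepsilon$ be a further new vertex. The vertex set of $\mathcal G$ is $\mathcal V=V\cup E^0\cup\dots\cup E^{2n}\cup\{\varepsilon\}$ (so $|\mathcal V|=(2n+1)|E|+n+1$). The edges of $\mathcal G$ are exactly: for every edge $e=\{u,v\}\in E$, the edges $\{u,e^0\}$ and $\{e^0,v\}$; the edges $\{e^i,e^{i+1}\}$ for $0\le i\le 2n-1$; and the edge $\{\varepsilon,e^0\}$. -}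

module Defs where

open import Data.Nat using (ℕ; zero; suc; _+_; _*_; _≤_)
open import Data.Fin using (Fin; zero; suc; inject₁) renaming (_<_ to _<ᶠ_)
open import Data.Fin.Subset using (Subset; _∈_; ∣_∣)
open import Data.List using (List; []; _∷_; _++_; map; concatMap; length; filter)
open import Data.List using (allFin)
open import Data.Bool using (Bool; true; false; T)
open import Data.Bool.Properties using (T?)
open import Data.Product using (Σ; ∃; _×_; _,_; proj₁; proj₂)
open import Data.Sum using (_⊎_)
open import Relation.Nullary using (¬_)
open import Relation.Binary.PropositionalEquality using (_≡_; _≢_)
open import Function.Definitions using (Injective)

-- The edge set E is given as an injective enumeration
-- edge : Fin m → Fin n × Fin n, each edge {u,v} written as (u , v) with
-- u < v; so there are no loops, no multi-edges, and |E| = m.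

record Graph (n : ℕ) : Set where
  field
    m       : ℕ
    edge    : Fin m → Fin n × Fin n
    ordered : ∀ e → proj₁ (edge e) <ᶠ proj₂ (edge e)
    inj     : Injective _≡_ _≡_ edge

open Graph public

Adj : ∀ {n} (G : Graph n) → Fin n → Fin n → Set
Adj G u v = Σ (Fin (m G)) λ e → (edge G e ≡ (u , v)) ⊎ (edge G e ≡ (v , u))

data Reach {n} (G : Graph n) : Fin n → Fin n → Set where
  here : ∀ {u} → Reach G u u
  step : ∀ {u w v} → Adj G u w → Reach G w v → Reach G u v

Connected : ∀ {n} → Graph n → Set
Connected {n} G = ∀ (u v : Fin n) → Reach G u v

Independent : ∀ {n} → Graph n → Subset n → Set
Independent G I = ∀ u v → u ∈ I → v ∈ I → ¬ Adj G u v

IsIndependenceNumber : ∀ {n} → Graph n → ℕ → Set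
IsIndependenceNumber {n} G k =
  (Σ (Subset n) λ I → Independent G I × ∣ I ∣ ≡ k) ×
  (∀ (I : Subset n) → Independent G I → ∣ I ∣ ≤ k)

-- The construction 𝒢 from G.
-- Vertices: V u (u ∈ V), C e i = e^i (e ∈ E, 0 ≤ i ≤ 2n), and ε.

data GVert {n} (G : Graph n) : Set where
  V : Fin n → GVert G
  C : Fin (m G) → Fin (suc (2 * n)) → GVert G
  ε : GVert G

-- one orientation of each edge of 𝒢
data GBase {n} (G : Graph n) : GVert G → GVert G → Set where
  end₁  : ∀ e → GBase G (V (proj₁ (edge G e))) (C e zero)
  end₂  : ∀ e → GBase G (C e zero) (V (proj₂ (edge G e)))
  chain : ∀ e (i : Fin (2 * n)) → GBase G (C e (inject₁ i)) (C e (suc i))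
  eps   : ∀ e → GBase G ε (C e zero)

GAdj : ∀ {n} (G : Graph n) → GVert G → GVert G → Set
GAdj G x y = GBase G x y ⊎ GBase G y x

allGVert : ∀ {n} (G : Graph n) → List (GVert G)
allGVert {n} G =
  map V (allFin n) ++
  (concatMap (λ e → map (C e) (allFin (suc (2 * n)))) (allFin (m G)) ++
   (ε ∷ []))

GSubset : ∀ {n} → Graph n → Set
GSubset G = GVert G → Bool

_∈ᴳ_ : ∀ {n} {G : Graph n} → GVert G → GSubset G → Set
x ∈ᴳ F = T (F x)

card : ∀ {n} {G : Graph n} → GSubset G → ℕ
card {G = G} F = length (filter (λ x → T? (F x)) (allGVert G))

Forced : ∀ {n} (G : Graph n) → GSubset G → GVert G → Set
Forced G F v =
  ¬ (v ∈ᴳ F) ×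
  Σ (GVert G) λ u → u ∈ᴳ F × GAdj G u v ×
    (∀ w → ¬ (w ∈ᴳ F) → GAdj G u w → w ≡ v)

Stalled : ∀ {n} (G : Graph n) → GSubset G → Set
Stalled G F = ∀ v → ¬ Forced G F v

Proper : ∀ {n} (G : Graph n) → GSubset G → Set
Proper G F = ¬ (∀ x → x ∈ᴳ F)

-- A stalled set S cannot stop halfway along a chain e⁰ – e¹ – … – e²ⁿ: if it
-- contains the leaf e²ⁿ it contains the whole chain, and otherwise it contains
-- no two consecutive eⁱ, hence at most n + 1 of them. So if some chain has its
-- leaf outside S, that chain alone misses n vertices, which pays for V ∪ {ε}
-- up to one vertex, and k ≥ 1. If every chain lies in S, then e⁰ (for e = uv)
-- has at most one of u, v, ε outside S. With ε ∈ S this makes u ∈ S ⇔ v ∈ S,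
-- so by connectivity S misses all of V (S being proper); with ε ∉ S, u and v
-- are never both in S, so S ∩ V is independent. Either way at most k vertices
-- of V ∪ {ε} lie in S.
module Submission where

open import Defs
open import Data.Nat using (ℕ; zero; suc; _+_; _*_; _≤_; z≤n; s≤s; ⌊_/2⌋; ⌈_/2⌉)
open import Data.Nat.Properties
open import Data.Fin using (Fin; zero; suc; inject₁; fromℕ) renaming (_<_ to _<ᶠ_)
open import Data.Fin.Properties using (any?; fromℕ≢inject₁; inject₁-injective)
open import Data.Fin.Induction using (>-weakInduction)
open import Data.Fin.Subset using (Subset; _∈_; ∣_∣; ⁅_⁆) renaming (⊥ to ∅)
open import Data.Fin.Subset.Properties using (∣p∣≤n; ∣⊥∣≡0; p⊆q⇒∣p∣≤∣q∣; x∈⁅y⁆⇒x≡y; ∣⁅x⁆∣≡1)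
open import Data.Vec as Vec using (_∷_)
open import Data.Vec.Properties using (lookup∘tabulate; []=⇒lookup)
open import Data.List as List using (List; []; _∷_; _++_; map; concatMap; length; filter; allFin)
open import Data.Nat.ListAction using (sum)
open import Data.List.Properties
  using (filter-++; filter-reject; length-++; length-filter; map-tabulate; map-cong; length-tabulate)
open import Data.List.Membership.Propositional using () renaming (_∈_ to _∈ˡ_)
open import Data.List.Membership.Propositional.Properties using (∈-allFin)
open import Data.List.Relation.Unary.Any using (here; there)
open import Data.Bool using (Bool; true; false; T)
open import Data.Bool.Properties using (T?)
open import Data.Unit using (tt)
open import Data.Empty using (⊥; ⊥-elim)
open import Data.Product using (∃-syntax; _×_; _,_; proj₁; proj₂)
open import Data.Sum using (_⊎_; inj₁; inj₂; [_,_]′)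
open import Function using (_∘_; id)
open import Relation.Nullary using (¬_; yes; no)
open import Relation.Nullary.Decidable using (¬?; decidable-stable)
open import Relation.Binary.PropositionalEquality
open import Algebra.Properties.CommutativeSemigroup +-commutativeSemigroup
  using (x∙yz≈y∙xz; x∙yz≈yx∙z; xy∙z≈xz∙y)

count : ∀ {A : Set} → (A → Bool) → List A → ℕ
count P xs = length (filter (λ x → T? (P x)) xs)

count-++ : ∀ {A : Set} (P : A → Bool) xs ys → count P (xs ++ ys) ≡ count P xs + count P ys
count-++ P xs ys = trans (cong length (filter-++ (λ x → T? (P x)) xs ys)) (length-++ (filter _ xs))

count-concatMap : ∀ {A B : Set} (P : B → Bool) (f : A → List B) xs →
  count P (concatMap f xs) ≡ sum (map (count P ∘ f) xs)
count-concatMap P f []       = refl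
count-concatMap P f (x ∷ xs) =
  trans (count-++ P (f x) (concatMap f xs)) (cong (count P (f x) +_) (count-concatMap P f xs))

count-tabulate : ∀ {A : Set} (P : A → Bool) {N} (f : Fin N → A) →
  count P (List.tabulate f) ≡ ∣ Vec.tabulate (P ∘ f) ∣
count-tabulate P {zero}  f = refl
count-tabulate P {suc N} f with P (f zero)
... | true  = cong suc (count-tabulate P (λ i → f (suc i)))
... | false = count-tabulate P (λ i → f (suc i))

count-map-allFin : ∀ {A : Set} (P : A → Bool) {N} (f : Fin N → A) →
  count P (map f (allFin N)) ≡ ∣ Vec.tabulate (P ∘ f) ∣
count-map-allFin P f = trans (cong (count P) (map-tabulate id f)) (count-tabulate P f)

∈-tabulate⇒T : ∀ {N} {f : Fin N → Bool} {i} → i ∈ Vec.tabulate f → T (f i)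
∈-tabulate⇒T {f = f} {i} i∈ = subst T (sym (trans (sym (lookup∘tabulate f i)) ([]=⇒lookup i∈))) tt

length-allFin*c≡c*M : ∀ M c → length (allFin M) * c ≡ c * M
length-allFin*c≡c*M M c = trans (cong (_* c) (length-tabulate {n = M} id)) (*-comm M c)

sum-map-≤ : ∀ {A : Set} (h : A → ℕ) {c} → (∀ x → h x ≤ c) → ∀ xs → sum (map h xs) ≤ length xs * c
sum-map-≤ h h≤c []       = z≤n
sum-map-≤ h h≤c (x ∷ xs) = +-mono-≤ (h≤c x) (sum-map-≤ h h≤c xs)

sum-map-+-≤ : ∀ {A : Set} (h : A → ℕ) {c d x xs} →
  (∀ y → h y ≤ c) → h x + d ≤ c → x ∈ˡ xs → sum (map h xs) + d ≤ length xs * c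
sum-map-+-≤ h {d = d} h≤c hx+d≤c (here {xs = xs} refl) = begin
  h _ + sum (map h xs) + d ≡⟨ xy∙z≈xz∙y (h _) _ d ⟩
  h _ + d + sum (map h xs) ≤⟨ +-mono-≤ hx+d≤c (sum-map-≤ h h≤c xs) ⟩
  _                        ∎
  where open ≤-Reasoning
sum-map-+-≤ h {d = d} h≤c hx+d≤c (there {x = y} {xs = xs} x∈xs) = begin
  h y + sum (map h xs) + d   ≡⟨ +-assoc (h y) _ d ⟩
  h y + (sum (map h xs) + d) ≤⟨ +-mono-≤ (h≤c y) (sum-map-+-≤ h h≤c hx+d≤c x∈xs) ⟩
  _                          ∎
  where open ≤-Reasoning

allFin-sum-≤ : ∀ {M c} (h : Fin M → ℕ) → (∀ i → h i ≤ c) → sum (map h (allFin M)) ≤ c * M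
allFin-sum-≤ {M} {c} h h≤c =
  subst (sum (map h (allFin M)) ≤_) (length-allFin*c≡c*M M c) (sum-map-≤ h h≤c (allFin M))

allFin-sum-+-≤ : ∀ {M c d} (h : Fin M → ℕ) i → (∀ j → h j ≤ c) → h i + d ≤ c →
  sum (map h (allFin M)) + d ≤ c * M
allFin-sum-+-≤ {M} {c} {d} h i h≤c hi+d≤c =
  subst (sum (map h (allFin M)) + d ≤_) (length-allFin*c≡c*M M c) (sum-map-+-≤ h h≤c hi+d≤c (∈-allFin i))

-- A path on Fin (suc N) has the edges inject₁ i — suc i.
NoAdjacent : ∀ {N} → (Fin (suc N) → Bool) → Set
NoAdjacent {N} g = ∀ (i : Fin N) → ¬ (T (g (inject₁ i)) × T (g (suc i)))

∣x∷y∷p∣≤1+∣p∣ : ∀ x y {N} (p : Subset N) → ¬ (T x × T y) → ∣ x ∷ y ∷ p ∣ ≤ suc ∣ p ∣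
∣x∷y∷p∣≤1+∣p∣ true  true  p ¬xy = ⊥-elim (¬xy (tt , tt))
∣x∷y∷p∣≤1+∣p∣ true  false p ¬xy = ≤-refl
∣x∷y∷p∣≤1+∣p∣ false true  p ¬xy = ≤-refl
∣x∷y∷p∣≤1+∣p∣ false false p ¬xy = n≤1+n _

∣tabulate∣≤⌈n/2⌉ : ∀ {N} (g : Fin (suc N) → Bool) → NoAdjacent g → ∣ Vec.tabulate g ∣ ≤ ⌈ suc N /2⌉
∣tabulate∣≤⌈n/2⌉ {zero}        g noAdj = ∣p∣≤n (Vec.tabulate g)
∣tabulate∣≤⌈n/2⌉ {suc zero}    g noAdj = ∣x∷y∷p∣≤1+∣p∣ _ _ Vec.[] (noAdj zero)
∣tabulate∣≤⌈n/2⌉ {suc (suc N)} g noAdj =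
  ≤-trans (∣x∷y∷p∣≤1+∣p∣ _ _ (Vec.tabulate (λ a → g (suc (suc a)))) (noAdj zero))
          (s≤s (∣tabulate∣≤⌈n/2⌉ (λ a → g (suc (suc a))) (λ i → noAdj (suc (suc i)))))

⌈1+2n/2⌉≡1+n : ∀ n → ⌈ suc (2 * n) /2⌉ ≡ suc n
⌈1+2n/2⌉≡1+n n = cong suc (begin
  ⌊ n + (n + 0) /2⌋ ≡⟨ cong (λ x → ⌊ n + x /2⌋) (+-identityʳ n) ⟩
  ⌊ n + n /2⌋       ≡⟨ sym (n≡⌊n+n/2⌋ n) ⟩
  n                 ∎)
  where open ≡-Reasoning

-- The vertex suc b has lower neighbour inject₁ b and upper neighbours suc j
-- with inject₁ j ≡ suc b (none if suc b is the last vertex).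
BackwardClosed : ∀ {N} → (Fin (suc N) → Bool) → Set
BackwardClosed g = ∀ b → T (g (suc b)) → (∀ j → inject₁ j ≡ suc b → T (g (suc j))) → T (g (inject₁ b))

ForwardClosed : ∀ {N} → (Fin (suc N) → Bool) → Set
ForwardClosed g = ∀ b j → inject₁ j ≡ suc b → T (g (inject₁ b)) → T (g (suc b)) → T (g (suc j))

all-from-last : ∀ {N} (g : Fin (suc N) → Bool) → BackwardClosed g → T (g (fromℕ N)) → ∀ a → T (g a)
all-from-last {N} g back last = proj₁ ∘ >-weakInduction InWithUpper (last , no-upper) descend
  where
  InWithUpper : Fin (suc N) → Set
  InWithUpper a = T (g a) × (∀ j → inject₁ j ≡ a → T (g (suc j)))

  no-upper : ∀ j → inject₁ j ≡ fromℕ N → T (g (suc j))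
  no-upper j eq = ⊥-elim (fromℕ≢inject₁ (sym eq))

  descend : ∀ b → InWithUpper (suc b) → InWithUpper (inject₁ b)
  descend b (sb∈ , upper∈) =
    back b sb∈ upper∈ , λ j eq → subst (T ∘ g ∘ suc) (sym (inject₁-injective eq)) sb∈

noAdjacent-from-last : ∀ {N} (g : Fin (suc N) → Bool) → ForwardClosed g → ¬ T (g (fromℕ N)) → NoAdjacent g
noAdjacent-from-last {zero}  g fwd last∉ ()
noAdjacent-from-last {suc N} g fwd last∉ = >-weakInduction (¬_ ∘ BothIn) (last∉ ∘ proj₂) descend
  where
  BothIn : Fin (suc N) → Set
  BothIn i = T (g (inject₁ i)) × T (g (suc i))

  descend : ∀ i → ¬ BothIn (suc i) → ¬ BothIn (inject₁ i)
  descend i noPair (l , v) = noPair (v , fwd (inject₁ i) (suc i) refl l v)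

no-loop : ∀ {n} (G : Graph n) u → ¬ Adj G u u
no-loop G u (e , inj₁ q) = <-irrefl refl (subst (λ p → proj₁ p <ᶠ proj₂ p) q (ordered G e))
no-loop G u (e , inj₂ q) = <-irrefl refl (subst (λ p → proj₁ p <ᶠ proj₂ p) q (ordered G e))

independence-number-positive : ∀ {n} (G : Graph n) {k} → IsIndependenceNumber G k → Fin n → 1 ≤ k
independence-number-positive G (_ , maximal) u =
  subst (_≤ _) (∣⁅x⁆∣≡1 u) (maximal ⁅ u ⁆ singleton-independent)
  where
  singleton-independent : Independent G ⁅ u ⁆
  singleton-independent x y x∈ y∈ with x∈⁅y⁆⇒x≡y u x∈ | x∈⁅y⁆⇒x≡y u y∈
  ... | refl | refl = no-loop G u

module _ {n} {G : Graph n} where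

  chain-neighbour : ∀ {e a w} → GAdj G (C e a) w →
      (a ≡ zero × (w ≡ V (proj₁ (edge G e)) ⊎ w ≡ V (proj₂ (edge G e)) ⊎ w ≡ ε))
    ⊎ (∃[ j ] inject₁ j ≡ a × w ≡ C e (suc j))
    ⊎ (∃[ j ] suc j ≡ a × w ≡ C e (inject₁ j))
  chain-neighbour (inj₁ (end₂ e))    = inj₁ (refl , inj₂ (inj₁ refl))
  chain-neighbour (inj₁ (chain e i)) = inj₂ (inj₁ (i , refl , refl))
  chain-neighbour (inj₂ (end₁ e))    = inj₁ (refl , inj₁ refl)
  chain-neighbour (inj₂ (chain e i)) = inj₂ (inj₂ (i , refl , refl))
  chain-neighbour (inj₂ (eps e))     = inj₁ (refl , inj₂ (inj₂ refl))

  hub-neighbour : ∀ {e w} → GAdj G (C e zero) w →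
    (w ≡ V (proj₁ (edge G e)) ⊎ w ≡ V (proj₂ (edge G e)) ⊎ w ≡ ε) ⊎ ∃[ a ] w ≡ C e a
  hub-neighbour adj with chain-neighbour adj
  ... | inj₁ (_ , w∈ends)         = inj₁ w∈ends
  ... | inj₂ (inj₁ (j , _ , w≡C)) = inj₂ (suc j , w≡C)
  ... | inj₂ (inj₂ (j , () , _))

  suc-neighbour : ∀ {e b w} → GAdj G (C e (suc b)) w →
    w ≡ C e (inject₁ b) ⊎ ∃[ j ] inject₁ j ≡ suc b × w ≡ C e (suc j)
  suc-neighbour adj with chain-neighbour adj
  ... | inj₁ (() , _)
  ... | inj₂ (inj₁ upper)              = inj₂ upper
  ... | inj₂ (inj₂ (_ , refl , w≡C))   = inj₁ w≡C

  stalled-closed : ∀ {S : GSubset G} → Stalled G S → ∀ {x t} → x ∈ᴳ S → GAdj G x t →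
    (∀ w → GAdj G x w → w ≡ t ⊎ w ∈ᴳ S) → t ∈ᴳ S
  stalled-closed {S} stalled {x} {t} x∈ x~t others = decidable-stable (T? (S t)) λ t∉ →
    stalled t (t∉ , x , x∈ , x~t , λ w w∉ x~w → [ id , ⊥-elim ∘ w∉ ]′ (others w x~w))

vertexCount : ∀ {n} {G : Graph n} → GSubset G → ℕ
vertexCount S = ∣ Vec.tabulate (λ u → S (V u)) ∣

chainCount : ∀ {n} {G : Graph n} → GSubset G → Fin (m G) → ℕ
chainCount S e = ∣ Vec.tabulate (λ a → S (C e a)) ∣

chainsCount : ∀ {n} {G : Graph n} → GSubset G → ℕ
chainsCount {G = G} S = sum (map (chainCount S) (allFin (m G)))

εCount : ∀ {n} {G : Graph n} → GSubset G → ℕ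
εCount S = count S (ε ∷ [])

vertexCount≤n : ∀ {n} {G : Graph n} (S : GSubset G) → vertexCount S ≤ n
vertexCount≤n S = ∣p∣≤n (Vec.tabulate (λ u → S (V u)))

chainCount≤1+2n : ∀ {n} {G : Graph n} (S : GSubset G) e → chainCount S e ≤ suc (2 * n)
chainCount≤1+2n S e = ∣p∣≤n (Vec.tabulate (λ a → S (C e a)))

εCount≤1 : ∀ {n} {G : Graph n} (S : GSubset G) → εCount S ≤ 1
εCount≤1 S = length-filter (λ x → T? (S x)) (ε ∷ [])

card-decomposition : ∀ {n} {G : Graph n} (S : GSubset G) →
  card S ≡ vertexCount S + (chainsCount S + εCount S)
card-decomposition {n} {G} S = begin
  count S (map V (allFin n) ++ (concatMap chainVertices (allFin (m G)) ++ ε ∷ []))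
    ≡⟨ count-++ S (map V (allFin n)) _ ⟩
  count S (map V (allFin n)) + count S (concatMap chainVertices (allFin (m G)) ++ ε ∷ [])
    ≡⟨ cong₂ _+_ (count-map-allFin S V) (count-++ S (concatMap chainVertices (allFin (m G))) (ε ∷ [])) ⟩
  vertexCount S + (count S (concatMap chainVertices (allFin (m G))) + εCount S)
    ≡⟨ cong (λ x → vertexCount S + (x + εCount S)) count-chains ⟩
  vertexCount S + (chainsCount S + εCount S)
    ∎
  where
  open ≡-Reasoning
  chainVertices : Fin (m G) → List (GVert G)
  chainVertices e = map (C e) (allFin (suc (2 * n)))

  count-chains : count S (concatMap chainVertices (allFin (m G))) ≡ chainsCount S
  count-chains = trans (count-concatMap S chainVertices (allFin (m G)))
                       (cong sum (map-cong (λ e → count-map-allFin S (C e)) (allFin (m G))))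

module _ {n} {G : Graph n} {S : GSubset G} (stalled : Stalled G S) where

  chain-backwardClosed : ∀ e → BackwardClosed (λ a → S (C e a))
  chain-backwardClosed e b sb∈ upper∈ = stalled-closed stalled sb∈ (inj₂ (chain e b)) λ w adj →
    [ inj₁ , (λ { (j , eq , refl) → inj₂ (upper∈ j eq) }) ]′ (suc-neighbour adj)

  chain-forwardClosed : ∀ e → ForwardClosed (λ a → S (C e a))
  chain-forwardClosed e b j eq lower∈ sb∈ = stalled-closed stalled sb∈ b~j λ w adj →
    [ (λ { refl → inj₂ lower∈ }) , (λ { (j′ , eq′ , refl) → inj₁ (same-upper j′ eq′) }) ]′ (suc-neighbour adj)
    where
    same-upper : ∀ j′ → inject₁ j′ ≡ suc b → C e (suc j′) ≡ C e (suc j)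
    same-upper j′ eq′ = cong (λ i → C e (suc i)) (inject₁-injective (trans eq′ (sym eq)))

    b~j : GAdj G (C e (suc b)) (C e (suc j))
    b~j = inj₁ (subst (λ a → GBase G (C e a) (C e (suc j))) eq (chain e j))

  chain-full : ∀ e → T (S (C e (fromℕ (2 * n)))) → ∀ a → T (S (C e a))
  chain-full e = all-from-last (λ a → S (C e a)) (chain-backwardClosed e)

  chain-sparse : ∀ e → ¬ T (S (C e (fromℕ (2 * n)))) → chainCount S e ≤ suc n
  chain-sparse e leaf∉ = begin
    chainCount S e    ≤⟨ ∣tabulate∣≤⌈n/2⌉ (λ a → S (C e a)) noAdjacent ⟩
    ⌈ suc (2 * n) /2⌉ ≡⟨ ⌈1+2n/2⌉≡1+n n ⟩
    suc n             ∎
    where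
    open ≤-Reasoning
    noAdjacent : NoAdjacent (λ a → S (C e a))
    noAdjacent = noAdjacent-from-last (λ a → S (C e a)) (chain-forwardClosed e) leaf∉

  module _ (full : ∀ e a → T (S (C e a))) where

    hub-closed : ∀ e {t} → GAdj G (C e zero) t →
      (∀ w → w ≡ V (proj₁ (edge G e)) ⊎ w ≡ V (proj₂ (edge G e)) ⊎ w ≡ ε → w ≡ t ⊎ T (S w)) → T (S t)
    hub-closed e hub~t others = stalled-closed stalled (full e zero) hub~t λ w adj →
      [ others w , (λ { (a , refl) → inj₂ (full e a) }) ]′ (hub-neighbour adj)

    InV : Fin n → Set
    InV u = T (S (V u))

    module _ (ε∈ : T (S ε)) where

      end₂-in⇒end₁-in : ∀ e → InV (proj₂ (edge G e)) → InV (proj₁ (edge G e))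
      end₂-in⇒end₁-in e v∈ = hub-closed e (inj₂ (end₁ e)) λ
        { w (inj₁ refl) → inj₁ refl ; w (inj₂ (inj₁ refl)) → inj₂ v∈ ; w (inj₂ (inj₂ refl)) → inj₂ ε∈ }

      end₁-in⇒end₂-in : ∀ e → InV (proj₁ (edge G e)) → InV (proj₂ (edge G e))
      end₁-in⇒end₂-in e u∈ = hub-closed e (inj₁ (end₂ e)) λ
        { w (inj₁ refl) → inj₂ u∈ ; w (inj₂ (inj₁ refl)) → inj₁ refl ; w (inj₂ (inj₂ refl)) → inj₂ ε∈ }

      adjacent-in : ∀ {u v} → Adj G u v → InV v → InV u
      adjacent-in (e , inj₁ q) v∈ =
        subst InV (cong proj₁ q) (end₂-in⇒end₁-in e (subst InV (cong proj₂ (sym q)) v∈))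
      adjacent-in (e , inj₂ q) v∈ =
        subst InV (cong proj₂ q) (end₁-in⇒end₂-in e (subst InV (cong proj₁ (sym q)) v∈))

      reachable-in : ∀ {u v} → Reach G u v → InV v → InV u
      reachable-in here           v∈ = v∈
      reachable-in (step u~w w⇝v) v∈ = adjacent-in u~w (reachable-in w⇝v v∈)

      missing-vertex : Proper G S → ∃[ u ] ¬ InV u
      missing-vertex proper with any? (λ u → ¬? (T? (S (V u))))
      ... | yes missing = missing
      ... | no  none    = ⊥-elim (proper all-in)
        where
        all-in : ∀ x → x ∈ᴳ S
        all-in (V u)   = decidable-stable (T? (S (V u))) (λ u∉ → none (u , u∉))
        all-in (C e a) = full e a
        all-in ε       = ε∈

    module _ (ε∉ : ¬ T (S ε)) where

      ends-not-both-in : ∀ e → InV (proj₁ (edge G e)) → InV (proj₂ (edge G e)) → ⊥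
      ends-not-both-in e u∈ v∈ = ε∉ (hub-closed e (inj₂ (eps e)) λ
        { w (inj₁ refl) → inj₂ u∈ ; w (inj₂ (inj₁ refl)) → inj₂ v∈ ; w (inj₂ (inj₂ refl)) → inj₁ refl })

      vertices-independent : Independent G (Vec.tabulate (λ u → S (V u)))
      vertices-independent u v u∈ v∈ (e , inj₁ q) = ends-not-both-in e
        (subst InV (cong proj₁ (sym q)) (∈-tabulate⇒T u∈)) (subst InV (cong proj₂ (sym q)) (∈-tabulate⇒T v∈))
      vertices-independent u v u∈ v∈ (e , inj₂ q) = ends-not-both-in e
        (subst InV (cong proj₁ (sym q)) (∈-tabulate⇒T v∈)) (subst InV (cong proj₂ (sym q)) (∈-tabulate⇒T u∈))

module _ {n} {G : Graph n} {k} (independence : IsIndependenceNumber G k)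
         {S : GSubset G} (stalled : Stalled G S) where

  card-≤-with-open-chain : ∀ e → ¬ T (S (C e (fromℕ (2 * n)))) → card S ≤ suc (2 * n) * m G + k
  card-≤-with-open-chain e leaf∉ = begin
    card S                              ≡⟨ card-decomposition S ⟩
    vertexCount S + (chainsCount S + εCount S) ≤⟨ +-monoˡ-≤ (chainsCount S + εCount S) (vertexCount≤n S) ⟩
    n + (chainsCount S + εCount S)             ≡⟨ x∙yz≈yx∙z n (chainsCount S) (εCount S) ⟩
    chainsCount S + n + εCount S        ≤⟨ +-mono-≤ chains+n≤ ε≤k ⟩
    suc (2 * n) * m G + k               ∎
    where
    open ≤-Reasoning

    open-chain+n≤ : chainCount S e + n ≤ suc (2 * n)
    open-chain+n≤ = ≤-trans (+-monoˡ-≤ n (chain-sparse stalled e leaf∉))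
                            (≤-reflexive (cong (λ x → suc (n + x)) (sym (+-identityʳ n))))

    chains+n≤ : chainsCount S + n ≤ suc (2 * n) * m G
    chains+n≤ = allFin-sum-+-≤ {c = suc (2 * n)} (chainCount S) e (chainCount≤1+2n S) open-chain+n≤

    ε≤k : εCount S ≤ k
    ε≤k = ≤-trans (εCount≤1 S) (independence-number-positive G independence (proj₁ (edge G e)))

  vertices+ε≤k : Connected G → Proper G S → (∀ e a → T (S (C e a))) → vertexCount S + εCount S ≤ k
  vertices+ε≤k connected proper full with T? (S ε)
  ... | yes ε∈ = begin
    vertexCount S + εCount S ≤⟨ +-mono-≤ no-vertex-in (εCount≤1 S) ⟩
    1                        ≤⟨ independence-number-positive G independence u₀ ⟩
    k                        ∎
    where
    open ≤-Reasoning
    u₀ : Fin n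
    u₀ = proj₁ (missing-vertex stalled full ε∈ proper)

    none-in : ∀ u → u ∈ Vec.tabulate (λ u → S (V u)) → u ∈ ∅
    none-in u u∈ = ⊥-elim (proj₂ (missing-vertex stalled full ε∈ proper)
                     (reachable-in stalled full ε∈ (connected u₀ u) (∈-tabulate⇒T u∈)))

    no-vertex-in : vertexCount S ≤ 0
    no-vertex-in = ≤-trans (p⊆q⇒∣p∣≤∣q∣ (none-in _)) (≤-reflexive (∣⊥∣≡0 n))
  ... | no ε∉ = begin
    vertexCount S + εCount S ≡⟨ cong (λ x → vertexCount S + length x) (filter-reject (λ x → T? (S x)) ε∉) ⟩
    vertexCount S + 0        ≡⟨ +-identityʳ _ ⟩
    vertexCount S            ≤⟨ proj₂ independence _ (vertices-independent stalled full ε∉) ⟩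
    k                        ∎
    where open ≤-Reasoning

  card-≤-with-full-chains : Connected G → Proper G S → (∀ e → T (S (C e (fromℕ (2 * n))))) →
    card S ≤ suc (2 * n) * m G + k
  card-≤-with-full-chains connected proper leaves∈ = begin
    card S                                ≡⟨ card-decomposition S ⟩
    vertexCount S + (chainsCount S + εCount S)   ≡⟨ x∙yz≈y∙xz (vertexCount S) (chainsCount S) (εCount S) ⟩
    chainsCount S + (vertexCount S + εCount S) ≤⟨ +-mono-≤ (allFin-sum-≤ (chainCount S) (chainCount≤1+2n S))
                                                      (vertices+ε≤k connected proper full) ⟩
    suc (2 * n) * m G + k                 ∎
    where
    open ≤-Reasoning

    full : ∀ e a → T (S (C e a))
    full e = chain-full stalled e (leaves∈ e)

mainTheorem9 : ∀ {n} (G : Graph n) (k : ℕ) →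
    Connected G → IsIndependenceNumber G k →
    (S : GSubset G) → Proper G S → Stalled G S →
    card S ≤ suc (2 * n) * m G + k
mainTheorem9 {n} G k connected independence S proper stalled
  with any? (λ e → ¬? (T? (S (C e (fromℕ (2 * n))))))
... | yes (e , leaf∉) = card-≤-with-open-chain independence stalled e leaf∉
... | no  no-open     = card-≤-with-full-chains independence stalled connected proper
                          (λ e → decidable-stable (T? (S (C e (fromℕ (2 * n))))) (λ leaf∉ → no-open (e , leaf∉)))
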